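{- Let $G$ be a bridgeless cubic graph having a $2$-factor all of whose cycles are chordless cycles of length $5$. If the multigraph $G^*$ is bipartite, then $G$ has a Fulkerson covering.
   Context: $G^*$ denotes the multigraph obtained from $G$ by contracting each $5$-cycle of the given $2$-factor to a single vertex (the remaining edges, which form the perfect matching complementary to the $2$-factor, become the edges of $G^*$); $G^*$ is $5$-regular. A Fulkerson covering of $G$ is a family of $6$ perfect matchings of $G$ (not necessarily distinct) such that every edge of $G$ lies in exactly two of them. -}

module Defs where

open import Data.Bool using (Bool; true; false; _∧_; _∨_; not; if_then_else_)
open import Data.Nat using (ℕ)
open import Data.Fin using (Fin; _≟_)
open import Data.List using (List; allFin; map)
open import Data.Nat.ListAction using (sum)
open import Data.Product using (Σ; ∃; _×_)
open import Function.Definitions using (Injective)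
open import Relation.Binary.PropositionalEquality using (_≡_; _≢_)
open import Relation.Nullary.Decidable using (⌊_⌋)

Rel : ℕ → Set
Rel n = Fin n → Fin n → Bool

record Graph (n : ℕ) : Set where
  field
    adj    : Rel n
    sym    : ∀ u v → adj u v ≡ adj v u
    irrefl : ∀ v → adj v v ≡ false
open Graph public

count : ∀ {k} → (Fin k → Bool) → ℕ
count {k} p = sum (map (λ i → if p i then 1 else 0) (allFin k))

deg : ∀ {n} → Rel n → Fin n → ℕ
deg H v = count (H v)

Cubic : ∀ {n} → Graph n → Set
Cubic G = ∀ v → deg (adj G) v ≡ 3

IsSubgraph : ∀ {n} → Graph n → Rel n → Set
IsSubgraph G H = (∀ u v → H u v ≡ H v u) × (∀ u v → H u v ≡ true → adj G u v ≡ true)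

data Reach {n : ℕ} (H : Rel n) : Fin n → Fin n → Set where
  here : ∀ {u} → Reach H u u
  step : ∀ {u w v} → H u w ≡ true → Reach H w v → Reach H u v

removeEdge : ∀ {n} → Rel n → Fin n → Fin n → Rel n
removeEdge H a b x y =
  H x y ∧ not ((⌊ x ≟ a ⌋ ∧ ⌊ y ≟ b ⌋) ∨ (⌊ x ≟ b ⌋ ∧ ⌊ y ≟ a ⌋))

Bridgeless : ∀ {n} → Graph n → Set
Bridgeless G = ∀ u v → adj G u v ≡ true → Reach (removeEdge (adj G) u v) u v

IsTwoFactor : ∀ {n} → Graph n → Rel n → Set
IsTwoFactor G F = IsSubgraph G F × (∀ v → deg F v ≡ 2)

-- the component of F containing v has exactly 5 vertices
-- (for a 2-regular F this says the cycle through v has length 5)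
ComponentHasFiveVertices : ∀ {n} → Rel n → Fin n → Set
ComponentHasFiveVertices {n} F v =
  Σ (Fin 5 → Fin n) λ f →
    Injective _≡_ _≡_ f × (∀ i → Reach F v (f i)) × (∀ u → Reach F v u → ∃ λ i → f i ≡ u)

CyclesChordless : ∀ {n} → Graph n → Rel n → Set
CyclesChordless G F = ∀ u v → Reach F u v → adj G u v ≡ true → F u v ≡ true

-- G* (G with each cycle of F contracted to a vertex; edges = edges of G not in F)
-- is bipartite: a 2-colouring of the vertices of G*, i.e. a colouring of V(G)
-- constant on the cycles of F, such that every edge of G* joins different colours.
ContractionBipartite : ∀ {n} → Graph n → Rel n → Set
ContractionBipartite {n} G F =
  Σ (Fin n → Bool) λ c →
    (∀ u v → Reach F u v → c u ≡ c v) ×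
    (∀ u v → adj G u v ≡ true → F u v ≡ false → c u ≢ c v)

IsPerfectMatching : ∀ {n} → Graph n → Rel n → Set
IsPerfectMatching G M = IsSubgraph G M × (∀ v → deg M v ≡ 1)

FulkersonCovering : ∀ {n} → Graph n → Set
FulkersonCovering {n} G =
  Σ (Fin 6 → Rel n) λ M →
    (∀ i → IsPerfectMatching G (M i)) ×
    (∀ u v → adj G u v ≡ true → count (λ i → M i u v) ≡ 2)

-- The edges of G not in the 2-factor form a perfect matching Q, and G* is the
-- multigraph of Q on the 5-cycles.  Being bipartite and 5-regular, G* has a proper
-- 5-edge-colouring (König's theorem, via Kempe chains); on G this is a
-- colouring of the vertices that agrees at both ends of every Q-edge and is injective
-- on every 5-cycle.  For each colour k take the Q-edges of colour k together with, on
-- every cycle, the two edges next to its vertex of colour k.  These five perfect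
-- matchings and Q cover a Q-edge twice (Q and its colour) and a cycle edge uv twice
-- (the colours of the two cycle vertices flanking uv, which are distinct).

module Submission where

open import Data.Bool using (Bool; true; false; _∧_; _∨_; not; _xor_; if_then_else_)
open import Data.Bool.Properties as B
  using (∧-identityʳ; ∧-zeroʳ; ∨-comm; ¬-not; not-¬; not-distribˡ-xor; not-distribʳ-xor)
open import Data.Empty using (⊥; ⊥-elim)
open import Data.Fin using (Fin; zero; suc; _≟_; punchOut)
open import Data.Fin.Permutation.Components using (transpose; transpose-inverse)
open import Data.Fin.Properties using (any?; ¬∀⟶∃¬; injective⇒≤; punchOut-injective)
open import Data.List.Properties using (map-tabulate)
open import Data.Maybe as Maybe using (Maybe; just; nothing)
open import Data.Maybe.Properties as M using (just-injective)
open import Data.Nat using (ℕ; zero; suc; _+_; _≤_; _<_; z≤n; s≤s)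
open import Data.Nat.ListAction using (sum)
open import Data.Nat.Properties
  using (≤-trans; <-≤-trans; ≤-pred; <⇒≱; n≤1+n; 1+n≰n; +-identityʳ; +-mono-≤; +-mono-≤-<; ≤-refl;
         0≢1+n; suc-injective; +-cancelˡ-≡; +-commutativeSemigroup)
open import Algebra.Properties.CommutativeSemigroup +-commutativeSemigroup using (interchange)
open import Data.Product as Prod using (Σ; _×_; _,_; proj₁; proj₂)
open import Data.Sum as Sum using (_⊎_; inj₁; inj₂; [_,_]′)
open import Function using (_∘_; id; _⇔_; mk⇔; case_of_)
open import Function.Definitions using (Injective)
open import Relation.Binary using (Decidable; IsDecEquivalence)
open import Relation.Binary.PropositionalEquality
open import Relation.Nullary using (¬_; ¬?; Dec; yes; no; _×-dec_; _⊎-dec_)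
open import Relation.Nullary.Decidable using (does; dec-true; dec-false; does-⇔; map′)
open import Defs hiding (sym)

private variable k : ℕ

does-true : {P : Set} (P? : Dec P) → does P? ≡ true → P
does-true (yes p) _ = p

one-if : Bool → ℕ
one-if b = if b then 1 else 0

count-suc : (p : Fin (suc k) → Bool) → count p ≡ one-if (p zero) + count (p ∘ suc)
count-suc p = cong (one-if (p zero) +_) (cong sum
  (trans (map-tabulate suc (one-if ∘ p)) (sym (map-tabulate id (one-if ∘ p ∘ suc)))))

count-cong : {p q : Fin k → Bool} → (∀ i → p i ≡ q i) → count p ≡ count q
count-cong {zero}  e = refl
count-cong {suc k} {p} {q} e
  rewrite count-suc p | count-suc q | e zero | count-cong (e ∘ suc) = refl

count-empty : (p : Fin k → Bool) → (∀ i → p i ≡ false) → count p ≡ 0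
count-empty {zero}  p e = refl
count-empty {suc k} p e rewrite count-suc p | e zero = count-empty (p ∘ suc) (e ∘ suc)

one-if≤1 : ∀ b → one-if b ≤ 1
one-if≤1 true  = s≤s z≤n
one-if≤1 false = z≤n

count≤ : (p : Fin k → Bool) → count p ≤ k
count≤ {zero}  p = z≤n
count≤ {suc k} p rewrite count-suc p = +-mono-≤ (one-if≤1 (p zero)) (count≤ (p ∘ suc))

one-if-mono : ∀ {a b} → (a ≡ true → b ≡ true) → one-if a ≤ one-if b
one-if-mono {false} h = z≤n
one-if-mono {true}  h rewrite h refl = ≤-refl

count-mono : {p q : Fin k → Bool} → (∀ i → p i ≡ true → q i ≡ true) → count p ≤ count q
count-mono {zero}  h = z≤n
count-mono {suc k} {p} {q} h rewrite count-suc p | count-suc q =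
  +-mono-≤ (one-if-mono (h zero)) (count-mono (h ∘ suc))

count-mono-< : {p q : Fin k → Bool} → (∀ i → p i ≡ true → q i ≡ true) →
               ∀ i → q i ≡ true → p i ≡ false → count p < count q
count-mono-< {suc k} {p} {q} h zero qi pi rewrite count-suc p | count-suc q | qi | pi =
  s≤s (count-mono (h ∘ suc))
count-mono-< {suc k} {p} {q} h (suc i) qi pi rewrite count-suc p | count-suc q =
  +-mono-≤-< (one-if-mono (h zero)) (count-mono-< (h ∘ suc) i qi pi)

one-if-split : ∀ a b → one-if a ≡ one-if (a ∧ b) + one-if (a ∧ not b)
one-if-split false b     = refl
one-if-split true  false = refl
one-if-split true  true  = refl

count-split : (p q : Fin k → Bool) →
              count p ≡ count (λ i → p i ∧ q i) + count (λ i → p i ∧ not (q i))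
count-split {zero}  p q = refl
count-split {suc k} p q = begin
  count p
    ≡⟨ count-suc p ⟩
  one-if (p zero) + count (p ∘ suc)
    ≡⟨ cong₂ _+_ (one-if-split (p zero) (q zero)) (count-split (p ∘ suc) (q ∘ suc)) ⟩
  (one-if (p zero ∧ q zero) + one-if (p zero ∧ not (q zero))) + (count pq′ + count pq̄′)
    ≡⟨ interchange (one-if (p zero ∧ q zero)) _ (count pq′) _ ⟩
  (one-if (p zero ∧ q zero) + count pq′) + (one-if (p zero ∧ not (q zero)) + count pq̄′)
    ≡⟨ sym (cong₂ _+_ (count-suc (λ i → p i ∧ q i)) (count-suc (λ i → p i ∧ not (q i)))) ⟩
  count (λ i → p i ∧ q i) + count (λ i → p i ∧ not (q i)) ∎
  where
  open ≡-Reasoning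
  pq′ pq̄′ : Fin k → Bool
  pq′  i = p (suc i) ∧ q (suc i)
  pq̄′ i = p (suc i) ∧ not (q (suc i))

count-point : (p : Fin k → Bool) (a : Fin k) → count (λ y → p y ∧ does (y ≟ a)) ≡ one-if (p a)
count-point {suc k} p zero = begin
  count (λ y → p y ∧ does (y ≟ zero))
    ≡⟨ count-suc (λ y → p y ∧ does (y ≟ zero)) ⟩
  one-if (p zero ∧ true) + count (λ y → p (suc y) ∧ false)
    ≡⟨ cong₂ _+_ (cong one-if (∧-identityʳ (p zero)))
                 (count-empty (λ y → p (suc y) ∧ false) (∧-zeroʳ ∘ p ∘ suc)) ⟩
  one-if (p zero) + 0
    ≡⟨ +-identityʳ _ ⟩
  one-if (p zero) ∎
  where open ≡-Reasoning
count-point {suc k} p (suc a) = begin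
  count (λ y → p y ∧ does (y ≟ suc a))
    ≡⟨ count-suc (λ y → p y ∧ does (y ≟ suc a)) ⟩
  one-if (p zero ∧ false) + count (λ y → p (suc y) ∧ does (y ≟ a))
    ≡⟨ cong (λ b → one-if b + count (λ y → p (suc y) ∧ does (y ≟ a))) (∧-zeroʳ (p zero)) ⟩
  count (λ y → p (suc y) ∧ does (y ≟ a))
    ≡⟨ count-point (p ∘ suc) a ⟩
  one-if (p (suc a)) ∎
  where open ≡-Reasoning

_∖_ : (Fin k → Bool) → Fin k → Fin k → Bool
(p ∖ a) y = p y ∧ not (does (y ≟ a))

count-∖ : (p : Fin k → Bool) (a : Fin k) → count p ≡ one-if (p a) + count (p ∖ a)
count-∖ p a = trans (count-split p (λ y → does (y ≟ a))) (cong (_+ count (p ∖ a)) (count-point p a))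

∖-true : (p : Fin k → Bool) {a y : Fin k} → p y ≡ true → y ≢ a → (p ∖ a) y ≡ true
∖-true p {a} {y} py y≢a rewrite py | dec-false (y ≟ a) y≢a = refl

∖-true⇒true : (p : Fin k → Bool) {a y : Fin k} → (p ∖ a) y ≡ true → p y ≡ true
∖-true⇒true p {y = y} h with p y
... | true = refl

∖-true⇒≢ : (p : Fin k → Bool) {a y : Fin k} → (p ∖ a) y ≡ true → y ≢ a
∖-true⇒≢ p {a} h refl with () ← trans (sym h) (trans (cong (λ b → p a ∧ not b) (dec-true (a ≟ a) refl))
                                                     (∧-zeroʳ (p a)))

count-∖-true : (p : Fin k → Bool) {a : Fin k} → p a ≡ true → count p ≡ suc (count (p ∖ a))
count-∖-true p {a} pa = trans (count-∖ p a) (cong (λ b → one-if b + count (p ∖ a)) pa)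

count≡0⇒false : (p : Fin k → Bool) → count p ≡ 0 → ∀ i → p i ≡ false
count≡0⇒false p #p≡0 i with p i in pi
... | false = refl
... | true  = ⊥-elim (0≢1+n (trans (sym #p≡0) (count-∖-true p pi)))

count≡suc⇒witness : (p : Fin k → Bool) {m : ℕ} → count p ≡ suc m → Σ (Fin k) λ i → p i ≡ true
count≡suc⇒witness p #p≡1+m with any? (λ i → p i B.≟ true)
... | yes witness = witness
... | no  ∄i      = ⊥-elim (0≢1+n (trans (sym (count-empty p (λ i → ¬-not (∄i ∘ (i ,_))))) #p≡1+m))

count≡1⇒unique : (p : Fin k → Bool) → count p ≡ 1 →
                 Σ (Fin k) λ i → p i ≡ true × (∀ j → p j ≡ true → j ≡ i)
count≡1⇒unique p #p≡1 with i , pi ← count≡suc⇒witness p #p≡1 = i , pi , unique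
  where
  unique : ∀ j → p j ≡ true → j ≡ i
  unique j pj with j ≟ i
  ... | yes j≡i = j≡i
  ... | no  j≢i with () ← trans (sym (∖-true p pj j≢i))
                    (count≡0⇒false (p ∖ i) (suc-injective (trans (sym (count-∖-true p pi)) #p≡1)) j)

count≡2⇒pair : (p : Fin k → Bool) → count p ≡ 2 →
               Σ (Fin k) λ i → Σ (Fin k) λ j → i ≢ j × p i ≡ true × p j ≡ true ×
                 (∀ l → p l ≡ true → l ≡ i ⊎ l ≡ j)
count≡2⇒pair p #p≡2 with i , pi ← count≡suc⇒witness p #p≡2
  with j , p∖i-j , unique ← count≡1⇒unique (p ∖ i) (suc-injective (trans (sym (count-∖-true p pi)) #p≡2)) =
  i , j , ≢-sym (∖-true⇒≢ p p∖i-j) , pi , ∖-true⇒true p p∖i-j , pair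
  where
  pair : ∀ l → p l ≡ true → l ≡ i ⊎ l ≡ j
  pair l pl with l ≟ i
  ... | yes l≡i = inj₁ l≡i
  ... | no  l≢i = inj₂ (unique l (∖-true p pl l≢i))

∖-≢ : (p : Fin k → Bool) {a y : Fin k} → y ≢ a → (p ∖ a) y ≡ p y
∖-≢ p {a} {y} y≢a rewrite dec-false (y ≟ a) y≢a = ∧-identityʳ (p y)

∖-support : (p : Fin k → Bool) {a : Fin k} {R : Fin k → Set} →
            (∀ y → p y ≡ true → y ≡ a ⊎ R y) → ∀ y → (p ∖ a) y ≡ true → R y
∖-support p support y h with support y (∖-true⇒true p h)
... | inj₁ y≡a = ⊥-elim (∖-true⇒≢ p h y≡a)
... | inj₂ Ry  = Ry

count-one-point : (p : Fin k → Bool) {a : Fin k} → (∀ y → p y ≡ true → y ≡ a) → count p ≡ one-if (p a)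
count-one-point p {a} support = begin
  count p                       ≡⟨ count-∖ p a ⟩
  one-if (p a) + count (p ∖ a)  ≡⟨ cong (one-if (p a) +_) (count-empty (p ∖ a) none) ⟩
  one-if (p a) + 0              ≡⟨ +-identityʳ _ ⟩
  one-if (p a)                  ∎
  where
  open ≡-Reasoning
  none : ∀ y → (p ∖ a) y ≡ false
  none y with (p ∖ a) y in h
  ... | false = refl
  ... | true  = ⊥-elim (∖-true⇒≢ p h (support y (∖-true⇒true p h)))

count-two-points : (p : Fin k → Bool) {a b : Fin k} → a ≢ b → (∀ y → p y ≡ true → y ≡ a ⊎ y ≡ b) →
                   count p ≡ one-if (p a) + one-if (p b)
count-two-points p {a} {b} a≢b support = begin
  count p                             ≡⟨ count-∖ p a ⟩
  one-if (p a) + count (p ∖ a)        ≡⟨ cong (one-if (p a) +_) (count-one-point (p ∖ a) (∖-support p support)) ⟩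
  one-if (p a) + one-if ((p ∖ a) b)   ≡⟨ cong (λ t → one-if (p a) + one-if t) (∖-≢ p (a≢b ∘ sym)) ⟩
  one-if (p a) + one-if (p b)         ∎
  where open ≡-Reasoning

count-three-points : (p : Fin k → Bool) {a b c : Fin k} → a ≢ b → a ≢ c → b ≢ c →
                     (∀ y → p y ≡ true → y ≡ a ⊎ y ≡ b ⊎ y ≡ c) →
                     count p ≡ one-if (p a) + (one-if (p b) + one-if (p c))
count-three-points p {a} {b} {c} a≢b a≢c b≢c support = begin
  count p                                               ≡⟨ count-∖ p a ⟩
  one-if (p a) + count (p ∖ a)                          ≡⟨ cong (one-if (p a) +_)
                                                             (count-two-points (p ∖ a) b≢c (∖-support p support)) ⟩
  one-if (p a) + (one-if ((p ∖ a) b) + one-if ((p ∖ a) c)) ≡⟨ cong₂ (λ s t → one-if (p a) + (one-if s + one-if t))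
                                                             (∖-≢ p (a≢b ∘ sym)) (∖-≢ p (a≢c ∘ sym)) ⟩
  one-if (p a) + (one-if (p b) + one-if (p c))          ∎
  where open ≡-Reasoning

count≡2⇒other : (p : Fin k → Bool) → count p ≡ 2 →
                Σ (Fin k → Fin k) λ other → ∀ {v} → p v ≡ true →
                  p (other v) ≡ true × other v ≢ v × (∀ {y} → p y ≡ true → y ≡ v ⊎ y ≡ other v)
count≡2⇒other p #p≡2 with i , j , i≢j , pi , pj , pair ← count≡2⇒pair p #p≡2 = other , spec
  where
  other : Fin _ → Fin _
  other v = if does (v ≟ i) then j else i
  spec : ∀ {v} → p v ≡ true →
         p (other v) ≡ true × other v ≢ v × (∀ {y} → p y ≡ true → y ≡ v ⊎ y ≡ other v)
  spec {v} pv with v ≟ i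
  ... | yes refl = pj , ≢-sym i≢j , λ {y} py → pair y py
  ... | no v≢i with pair v pv
  ...   | inj₁ v≡i = ⊥-elim (v≢i v≡i)
  ...   | inj₂ refl = pi , i≢j , λ {y} py → Sum.swap (pair y py)

count-either : {i j : Fin k} → i ≢ j → count (λ y → does (y ≟ i) ∨ does (y ≟ j)) ≡ 2
count-either {i = i} {j} i≢j = begin
  count (λ y → does (y ≟ i) ∨ does (y ≟ j))
    ≡⟨ count-two-points (λ y → does (y ≟ i) ∨ does (y ≟ j)) i≢j support ⟩
  one-if (does (i ≟ i) ∨ does (i ≟ j)) + one-if (does (j ≟ i) ∨ does (j ≟ j))
    ≡⟨ cong₂ (λ s t → one-if (s ∨ does (i ≟ j)) + one-if (does (j ≟ i) ∨ t))
             (dec-true (i ≟ i) refl) (dec-true (j ≟ j) refl) ⟩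
  one-if true + one-if (does (j ≟ i) ∨ true)
    ≡⟨ cong (λ t → 1 + one-if t) (B.∨-zeroʳ (does (j ≟ i))) ⟩
  2 ∎
  where
  open ≡-Reasoning
  support : ∀ y → (does (y ≟ i) ∨ does (y ≟ j)) ≡ true → y ≡ i ⊎ y ≡ j
  support y h with y ≟ i | y ≟ j
  ... | yes y≡i | _       = inj₁ y≡i
  ... | no _    | yes y≡j = inj₂ y≡j

injective⇒surjective : (f : Fin k → Fin k) → Injective _≡_ _≡_ f → ∀ j → Σ (Fin k) λ i → f i ≡ j
injective⇒surjective {suc k} f f-inj j with any? (λ i → f i ≟ j)
... | yes hit  = hit
... | no  miss = ⊥-elim (1+n≰n (injective⇒≤ squeezed-injective))
  where
  j≢f : ∀ i → j ≢ f i
  j≢f i j≡fi = miss (i , sym j≡fi)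
  squeezed : Fin (suc k) → Fin k
  squeezed i = punchOut (j≢f i)
  squeezed-injective : Injective _≡_ _≡_ squeezed
  squeezed-injective {i} {i′} eq = f-inj (punchOut-injective (j≢f i) (j≢f i′) eq)

partial-misses : (v : Fin k → Maybe (Fin k)) (i : Fin k) → v i ≡ nothing →
                 Σ (Fin k) λ a → ∀ j → v j ≢ just a
partial-misses {k} v i vi≡nothing = Prod.map₂ (λ ¬hit j vj≡a → ¬hit (j , vj≡a))
  (¬∀⟶∃¬ k Hit (λ a → any? (λ j → M.≡-dec _≟_ (v j) (just a))) ¬all-hit)
  where
  Hit : Fin k → Set
  Hit a = Σ (Fin k) λ j → v j ≡ just a
  ¬all-hit : ¬ (∀ a → Hit a)
  ¬all-hit hit with injective⇒surjective (proj₁ ∘ hit) (λ {a} {a′} eq → just-injective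
                      (trans (sym (proj₂ (hit a))) (trans (cong v eq) (proj₂ (hit a′))))) i
  ... | a , j≡i with () ← trans (sym (proj₂ (hit a))) (trans (cong v j≡i) vi≡nothing)

module _ {n : ℕ} {E : Rel n} where

  reach-snoc : ∀ {u w v} → Reach E u w → E w v ≡ true → Reach E u v
  reach-snoc here         e = step e here
  reach-snoc (step e′ r) e = step e′ (reach-snoc r e)

  reach-trans : ∀ {u w v} → Reach E u w → Reach E w v → Reach E u v
  reach-trans here        r′ = r′
  reach-trans (step e r) r′ = step e (reach-trans r r′)

  reach-sym : (∀ u v → E u v ≡ E v u) → ∀ {u v} → Reach E u v → Reach E v u
  reach-sym E-sym here = here
  reach-sym E-sym {u} (step {w = w} e r) = reach-snoc (reach-sym E-sym r) (trans (E-sym w u) e)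

  reach-last : ∀ {u v} → Reach E u v → v ≡ u ⊎ Σ (Fin n) λ w → Reach E u w × E w v ≡ true
  reach-last here = inj₁ refl
  reach-last {u} (step e r) with reach-last r
  ... | inj₁ refl           = inj₂ (u , here , e)
  ... | inj₂ (w , r′ , e′) = inj₂ (w , step e r′ , e′)

anyᵇ : (Fin k → Bool) → Bool
anyᵇ p = does (any? (λ i → p i B.≟ true))

anyᵇ-intro : (p : Fin k → Bool) {i : Fin k} → p i ≡ true → anyᵇ p ≡ true
anyᵇ-intro p {i} pi = dec-true (any? (λ i → p i B.≟ true)) (i , pi)

anyᵇ-elim : (p : Fin k → Bool) → anyᵇ p ≡ true → Σ (Fin k) λ i → p i ≡ true
anyᵇ-elim p = does-true (any? (λ i → p i B.≟ true))

-- Reachability in a finite graph is decidable: the set of vertices reachable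
-- in at most m steps grows strictly until it is stable, so it is stable by m = k.
module Reachability {k : ℕ} (E : Rel k) (s : Fin k) where

  within : ℕ → Fin k → Bool
  within zero    y = does (y ≟ s)
  within (suc m) y = within m y ∨ anyᵇ (λ z → within m z ∧ E z y)

  within-sound : ∀ m {y} → within m y ≡ true → Reach E s y
  within-sound zero {y} h with y ≟ s
  ... | yes refl = here
  within-sound (suc m) {y} h with within m y in wy
  ... | true  = within-sound m wy
  ... | false with z , hz ← anyᵇ-elim (λ z → within m z ∧ E z y) h with within m z in wz
  ...   | true = reach-snoc (within-sound m wz) hz

  within-suc : ∀ m {y} → within m y ≡ true → within (suc m) y ≡ true
  within-suc m h rewrite h = refl

  within-start : ∀ m → within m s ≡ true
  within-start zero    = dec-true (s ≟ s) refl
  within-start (suc m) = within-suc m (within-start m)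

  within-step : ∀ m {z y} → within m z ≡ true → E z y ≡ true → within (suc m) y ≡ true
  within-step m {z} {y} wz e rewrite anyᵇ-intro (λ z → within m z ∧ E z y) (cong₂ _∧_ wz e) =
    B.∨-zeroʳ (within m y)

  Stable Grows : ℕ → Set
  Stable m = ∀ y → within (suc m) y ≡ true → within m y ≡ true
  Grows  m = Σ (Fin k) λ y → within (suc m) y ≡ true × within m y ≡ false

  stable-or-grows : ∀ m → Stable m ⊎ Grows m
  stable-or-grows m with any? (λ y → (within (suc m) y ∧ not (within m y)) B.≟ true)
  ... | yes (y , h) = inj₂ (y , and-not h)
    where
    and-not : ∀ {a b} → (a ∧ not b) ≡ true → a ≡ true × b ≡ false
    and-not {true} {false} refl = refl , refl
  ... | no none = inj₁ stable
    where
    stable : Stable m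
    stable y h with within m y B.≟ true
    ... | yes wy  = wy
    ... | no  ¬wy = ⊥-elim (none (y , cong₂ (λ a b → a ∧ not b) h (¬-not ¬wy)))

  stable-suc : ∀ m → Stable m → Stable (suc m)
  stable-suc m st y h with within (suc m) y in w
  ... | true = refl
  ... | false with z , hz ← anyᵇ-elim (λ z → within (suc m) z ∧ E z y) h with within (suc m) z in wz
  ...   | true = trans (sym w) (within-step m (st z wz) hz)

  grows-pred : ∀ m → Grows (suc m) → Grows m
  grows-pred m (y , new , old) with stable-or-grows m
  ... | inj₂ g  = g
  ... | inj₁ st with () ← trans (sym old) (stable-suc m st y new)

  grows-count : ∀ m → Grows m → count (within m) < count (within (suc m))
  grows-count m (y , new , old) = count-mono-< (λ _ → within-suc m) y new old

  grows⇒large : ∀ m → Grows m → suc (suc m) ≤ count (within (suc m))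
  grows⇒large zero    g = ≤-trans (s≤s start-counted) (grows-count 0 g)
    where
    start-counted : 1 ≤ count (within 0)
    start-counted rewrite count-∖-true (within 0) {s} (within-start 0) = s≤s z≤n
  grows⇒large (suc m) g = ≤-trans (s≤s (grows⇒large m (grows-pred m g))) (grows-count (suc m) g)

  within-closed : ∀ {z y} → within k z ≡ true → E z y ≡ true → within k y ≡ true
  within-closed {z} {y} wz e with stable-or-grows k
  ... | inj₁ st = st y (within-step k wz e)
  ... | inj₂ g  = ⊥-elim (<⇒≱ (grows⇒large k g) (≤-trans (count≤ (within (suc k))) (n≤1+n k)))

  within-complete : ∀ {u y} → within k u ≡ true → Reach E u y → within k y ≡ true
  within-complete wu here       = wu
  within-complete wu (step e r) = within-complete (within-closed wu e) r

reach? : {k : ℕ} (E : Rel k) → Decidable (Reach E)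
reach? {k} E s y = map′ (within-sound k) (within-complete (within-start k)) (within k y B.≟ true)
  where open Reachability E s

-- König's theorem for the bipartite multigraph whose vertices are the classes
-- of ∼ and whose edges are the pairs {x, p x}: it is properly d-edge-colourable
-- when every class has at most d elements.  Proof by Kempe-chain recolouring.
module EdgeColouring {n d : ℕ} {_∼_ : Fin n → Fin n → Set}
  (∼-isDecEquivalence : IsDecEquivalence _∼_)
  (class-covered : ∀ x → Σ (Fin d → Fin n) λ f → ∀ {y} → x ∼ y → Σ (Fin d) λ i → f i ≡ y)
  (p : Fin n → Fin n) (p-involutive : ∀ x → p (p x) ≡ x)
  (c : Fin n → Bool) (c-class : ∀ {x y} → x ∼ y → c x ≡ c y)
  (c-partner : ∀ x → c (p x) ≡ not (c x))
  where

  open IsDecEquivalence ∼-isDecEquivalence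
    renaming (refl to ∼-refl; sym to ∼-sym; trans to ∼-trans; _≟_ to _∼?_)

  partner-≁ : ∀ x → ¬ (x ∼ p x)
  partner-≁ x x∼px = not-¬ (sym (c-class x∼px)) (c-partner x)

  Partial : Set
  Partial = Fin n → Maybe (Fin d)

  _≟ₘ_ : (u v : Maybe (Fin d)) → Dec (u ≡ v)
  _≟ₘ_ = M.≡-dec _≟_

  record Valid (L : Partial) : Set where
    field
      partner : ∀ x → L (p x) ≡ L x
      proper  : ∀ {y y′ a} → y ∼ y′ → y ≢ y′ → L y ≡ just a → L y′ ≢ just a

  Missing : Partial → Fin n → Fin d → Set
  Missing L x a = ∀ {y} → x ∼ y → L y ≢ just a

  missing-colour : ∀ L {x} → L x ≡ nothing → Σ (Fin d) (Missing L x)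
  missing-colour L {x} Lx≡nothing with f , cover ← class-covered x with i , fi≡x ← cover ∼-refl =
    let a , absent = partial-misses (L ∘ f) i (trans (cong L fi≡x) Lx≡nothing)
    in a , λ x∼y Ly≡a → let j , fj≡y = cover x∼y in absent j (trans (cong L fj≡y) Ly≡a)

  _[_↦_] : Partial → Fin n → Fin d → Partial
  (L [ x ↦ a ]) y with y ≟ x | y ≟ p x
  ... | yes _ | _     = just a
  ... | no _  | yes _ = just a
  ... | no _  | no _  = L y

  module _ (L : Partial) (x : Fin n) (a : Fin d) where

    OnEdge : Fin n → Set
    OnEdge y = y ≡ x ⊎ y ≡ p x

    on-edge? : ∀ y → OnEdge y ⊎ (y ≢ x × y ≢ p x)
    on-edge? y with y ≟ x | y ≟ p x
    ... | yes y≡x | _        = inj₁ (inj₁ y≡x)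
    ... | no _    | yes y≡px = inj₁ (inj₂ y≡px)
    ... | no y≢x  | no y≢px  = inj₂ (y≢x , y≢px)

    assign-on : ∀ {y} → OnEdge y → (L [ x ↦ a ]) y ≡ just a
    assign-on {y} on with y ≟ x | y ≟ p x
    ... | yes _  | _       = refl
    ... | no _   | yes _   = refl
    ... | no y≢x | no y≢px = ⊥-elim ([ y≢x , y≢px ]′ on)

    assign-off : ∀ {y} → y ≢ x → y ≢ p x → (L [ x ↦ a ]) y ≡ L y
    assign-off {y} y≢x y≢px with y ≟ x | y ≟ p x
    ... | yes y≡x | _        = ⊥-elim (y≢x y≡x)
    ... | no _    | yes y≡px = ⊥-elim (y≢px y≡px)
    ... | no _    | no _     = refl

    assign-labelled : ∀ y → (L [ x ↦ a ]) y ≡ nothing → L y ≡ nothing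
    assign-labelled y L′y≡nothing with on-edge? y
    ... | inj₁ on           = case trans (sym (assign-on on)) L′y≡nothing of λ ()
    ... | inj₂ (y≢x , y≢px) = trans (sym (assign-off y≢x y≢px)) L′y≡nothing

    assign-valid : Valid L → Missing L x a → Missing L (p x) a → Valid (L [ x ↦ a ])
    assign-valid valid missing-x missing-px = record { partner = partner′ ; proper = proper′ }
      where
      open Valid valid

      partner′ : ∀ y → (L [ x ↦ a ]) (p y) ≡ (L [ x ↦ a ]) y
      partner′ y with on-edge? y
      ... | inj₁ (inj₁ refl) = trans (assign-on (inj₂ refl)) (sym (assign-on (inj₁ refl)))
      ... | inj₁ (inj₂ refl) = trans (assign-on (inj₁ (p-involutive x))) (sym (assign-on (inj₂ refl)))
      ... | inj₂ (y≢x , y≢px) = begin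
        (L [ x ↦ a ]) (p y) ≡⟨ assign-off (λ py≡x → y≢px (trans (sym (p-involutive y)) (cong p py≡x)))
                                           (λ py≡px → y≢x (trans (sym (p-involutive y))
                                                            (trans (cong p py≡px) (p-involutive x)))) ⟩
        L (p y)             ≡⟨ partner y ⟩
        L y                 ≡⟨ sym (assign-off y≢x y≢px) ⟩
        (L [ x ↦ a ]) y     ∎
        where open ≡-Reasoning

      on-edge-missing : ∀ {y y′} → OnEdge y → y ∼ y′ → L y′ ≢ just a
      on-edge-missing (inj₁ refl) = missing-x
      on-edge-missing (inj₂ refl) = missing-px

      edge-not-in-class : ∀ {y y′} → OnEdge y → OnEdge y′ → y ∼ y′ → y ≢ y′ → ⊥
      edge-not-in-class (inj₁ refl) (inj₁ refl) _     y≢y′ = y≢y′ refl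
      edge-not-in-class (inj₁ refl) (inj₂ refl) x∼px  _    = partner-≁ x x∼px
      edge-not-in-class (inj₂ refl) (inj₁ refl) px∼x  _    = partner-≁ x (∼-sym px∼x)
      edge-not-in-class (inj₂ refl) (inj₂ refl) _     y≢y′ = y≢y′ refl

      proper′ : ∀ {y y′ e} → y ∼ y′ → y ≢ y′ →
                (L [ x ↦ a ]) y ≡ just e → (L [ x ↦ a ]) y′ ≢ just e
      proper′ {y} {y′} y∼y′ y≢y′ L′y≡e L′y′≡e with on-edge? y | on-edge? y′
      ... | inj₁ on | inj₁ on′ = edge-not-in-class on on′ y∼y′ y≢y′
      ... | inj₁ on | inj₂ (y′≢x , y′≢px) = on-edge-missing on y∼y′
            (trans (sym (assign-off y′≢x y′≢px)) (trans L′y′≡e (trans (sym L′y≡e) (assign-on on))))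
      ... | inj₂ (y≢x , y≢px) | inj₁ on′ = on-edge-missing on′ (∼-sym y∼y′)
            (trans (sym (assign-off y≢x y≢px)) (trans L′y≡e (trans (sym L′y′≡e) (assign-on on′))))
      ... | inj₂ (y≢x , y≢px) | inj₂ (y′≢x , y′≢px) =
            proper y∼y′ y≢y′ (trans (sym (assign-off y≢x y≢px)) L′y≡e)
                             (trans (sym (assign-off y′≢x y′≢px)) L′y′≡e)

  -- Swapping a and b along the a/b-chain starting at w makes a missing at the
  -- classes of both x and p x.
  module Kempe {L : Partial} (valid : Valid L) {x : Fin n} {a b : Fin d}
               (a-missing : Missing L x a) (b-missing : Missing L (p x) b)
               {w : Fin n} (px∼w : p x ∼ w) (Lw≡a : L w ≡ just a) where

    open Valid valid

    a≢b : a ≢ b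
    a≢b refl = b-missing px∼w Lw≡a

    AB : Fin n → Set
    AB y = L y ≡ just a ⊎ L y ≡ just b

    AB? : ∀ y → Dec (AB y)
    AB? y = (L y ≟ₘ just a) ⊎-dec (L y ≟ₘ just b)

    AB-partner : ∀ {y} → AB y → AB (p y)
    AB-partner {y} = Sum.map (trans (partner y)) (trans (partner y))

    AB-class : ∀ {y y′} → y ∼ y′ → y ≢ y′ → AB y → AB y′ →
               L y ≡ just a × L y′ ≡ just b ⊎ L y ≡ just b × L y′ ≡ just a
    AB-class y∼y′ y≢y′ (inj₁ Ly≡a) (inj₁ Ly′≡a) = ⊥-elim (proper y∼y′ y≢y′ Ly≡a Ly′≡a)
    AB-class y∼y′ y≢y′ (inj₁ Ly≡a) (inj₂ Ly′≡b) = inj₁ (Ly≡a , Ly′≡b)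
    AB-class y∼y′ y≢y′ (inj₂ Ly≡b) (inj₁ Ly′≡a) = inj₂ (Ly≡b , Ly′≡a)
    AB-class y∼y′ y≢y′ (inj₂ Ly≡b) (inj₂ Ly′≡b) = ⊥-elim (proper y∼y′ y≢y′ Ly≡b Ly′≡b)

    isA : Fin n → Bool
    isA y = does (L y ≟ₘ just a)

    -- Along the chain partner edges and class edges alternate; crossing y says
    -- that the chain leaves y through its partner edge.
    crossing : Fin n → Bool
    crossing y = (c y xor c w) xor isA y

    Link : Bool → Fin n → Fin n → Set
    Link true  z y = y ≡ p z
    Link false z y = z ∼ y × z ≢ y

    Link? : ∀ t z y → Dec (Link t z y)
    Link? true  z y = y ≟ p z
    Link? false z y = (z ∼? y) ×-dec (¬? (z ≟ y))

    Step : Fin n → Fin n → Set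
    Step z y = AB z × AB y × Link (crossing z) z y

    E : Rel n
    E z y = does (AB? z ×-dec AB? y ×-dec Link? (crossing z) z y)

    E⇒Step : ∀ {z y} → E z y ≡ true → Step z y
    E⇒Step {z} {y} = does-true (AB? z ×-dec AB? y ×-dec Link? (crossing z) z y)

    Step⇒E : ∀ {z y} → Step z y → E z y ≡ true
    Step⇒E {z} {y} = dec-true (AB? z ×-dec AB? y ×-dec Link? (crossing z) z y)

    Chain : Fin n → Set
    Chain = Reach E w

    isA-a : ∀ {y} → L y ≡ just a → isA y ≡ true
    isA-a {y} Ly≡a = dec-true (L y ≟ₘ just a) Ly≡a

    isA-b : ∀ {y} → L y ≡ just b → isA y ≡ false
    isA-b {y} Ly≡b = dec-false (L y ≟ₘ just a) (λ Ly≡a → a≢b (just-injective (trans (sym Ly≡a) Ly≡b)))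

    crossing-start : crossing w ≡ true
    crossing-start rewrite B.xor-same (c w) = isA-a Lw≡a

    crossing-partner : ∀ z → crossing (p z) ≡ not (crossing z)
    crossing-partner z = begin
      (c (p z) xor c w) xor isA (p z)  ≡⟨ cong₂ (λ u v → (u xor c w) xor does (v ≟ₘ just a))
                                                  (c-partner z) (partner z) ⟩
      (not (c z) xor c w) xor isA z    ≡⟨ cong (_xor isA z) (sym (not-distribˡ-xor (c z) (c w))) ⟩
      not (c z xor c w) xor isA z      ≡⟨ sym (not-distribˡ-xor (c z xor c w) (isA z)) ⟩
      not (crossing z)                 ∎
      where open ≡-Reasoning

    crossing-class : ∀ {z y} → z ∼ y → z ≢ y → AB z → AB y → crossing y ≡ not (crossing z)
    crossing-class {z} {y} z∼y z≢y ABz ABy = begin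
      (c y xor c w) xor isA y        ≡⟨ cong₂ (λ u v → (u xor c w) xor v) (sym (c-class z∼y)) isA-flips ⟩
      (c z xor c w) xor not (isA z)  ≡⟨ sym (not-distribʳ-xor (c z xor c w) (isA z)) ⟩
      not (crossing z)               ∎
      where
      open ≡-Reasoning
      isA-flips : isA y ≡ not (isA z)
      isA-flips with AB-class z∼y z≢y ABz ABy
      ... | inj₁ (Lz≡a , Ly≡b) rewrite isA-a Lz≡a | isA-b Ly≡b = refl
      ... | inj₂ (Lz≡b , Ly≡a) rewrite isA-b Lz≡b | isA-a Ly≡a = refl

    step-partner : ∀ {z y} → Step z y → crossing z ≡ true → y ≡ p z
    step-partner (_ , _ , link) cz = subst (λ t → Link t _ _) cz link

    step-class : ∀ {z y} → Step z y → crossing z ≡ false → z ∼ y × z ≢ y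
    step-class (_ , _ , link) cz = subst (λ t → Link t _ _) cz link

    step-flips : ∀ {z y} → Step z y → crossing y ≡ not (crossing z)
    step-flips {z} st@(ABz , ABy , _) with crossing z B.≟ true
    ... | yes cz = trans (cong crossing (step-partner st cz)) (crossing-partner z)
    ... | no ¬cz = let z∼y , z≢y = step-class st (¬-not ¬cz) in crossing-class z∼y z≢y ABz ABy

    crossing-before : ∀ {z y} → Step z y → crossing z ≡ not (crossing y)
    crossing-before {z} st = trans (sym (B.not-involutive (crossing z))) (cong not (sym (step-flips st)))

    entered-by-partner : ∀ {z y} → Step z y → crossing y ≡ false → y ≡ p z
    entered-by-partner st cy = step-partner st (trans (crossing-before st) (cong not cy))

    entered-in-class : ∀ {z y} → Step z y → crossing y ≡ true → z ∼ y × z ≢ y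
    entered-in-class st cy = step-class st (trans (crossing-before st) (cong not cy))

    c-w : c w ≡ not (c x)
    c-w = trans (sym (c-class px∼w)) (c-partner x)

    -- Bipartiteness: a b-vertex in the class of x is left, not entered, by a partner edge.
    crossing-b-near-x : ∀ {y} → x ∼ y → L y ≡ just b → crossing y ≡ true
    crossing-b-near-x {y} x∼y Ly≡b = begin
      (c y xor c w) xor isA y          ≡⟨ cong₂ (λ u v → (u xor c w) xor v) (sym (c-class x∼y)) (isA-b Ly≡b) ⟩
      (c x xor c w) xor false          ≡⟨ B.xor-identityʳ (c x xor c w) ⟩
      c x xor c w                      ≡⟨ cong (c x xor_) c-w ⟩
      c x xor not (c x)                ≡⟨ sym (not-distribʳ-xor (c x) (c x)) ⟩
      not (c x xor c x)                ≡⟨ cong not (B.xor-same (c x)) ⟩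
      true                             ∎
      where open ≡-Reasoning

    no-three : ∀ {z y y′} → z ∼ y → y ∼ y′ → z ≢ y → y ≢ y′ → z ≢ y′ →
               AB z → AB y → AB y′ → ⊥
    no-three z∼y y∼y′ z≢y y≢y′ z≢y′ ABz ABy ABy′
      with AB-class z∼y z≢y ABz ABy | AB-class y∼y′ y≢y′ ABy ABy′
    ... | inj₁ (Lz≡a , _) | inj₂ (_ , Ly′≡a) = proper (∼-trans z∼y y∼y′) z≢y′ Lz≡a Ly′≡a
    ... | inj₂ (Lz≡b , _) | inj₁ (_ , Ly′≡b) = proper (∼-trans z∼y y∼y′) z≢y′ Lz≡b Ly′≡b
    ... | inj₁ (_ , Ly≡b) | inj₁ (Ly≡a , _)  = a≢b (just-injective (trans (sym Ly≡a) Ly≡b))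
    ... | inj₂ (_ , Ly≡a) | inj₂ (Ly≡b , _)  = a≢b (just-injective (trans (sym Ly≡a) Ly≡b))

    reach-AB : ∀ {u y} → AB u → Reach E u y → AB y
    reach-AB ABu here       = ABu
    reach-AB ABu (step e r) = reach-AB (proj₁ (proj₂ (E⇒Step e))) r

    chain-AB : ∀ {y} → Chain y → AB y
    chain-AB = reach-AB (inj₁ Lw≡a)

    chain-partner : ∀ {y} → Chain y → Chain (p y)
    chain-partner {y} r with crossing y B.≟ true
    ... | yes cy = reach-snoc r (Step⇒E (chain-AB r , AB-partner (chain-AB r) ,
                                         subst (λ t → Link t y (p y)) (sym cy) refl))
    ... | no ¬cy with reach-last r
    ...   | inj₁ refl = ⊥-elim (¬cy crossing-start)
    ...   | inj₂ (z , rz , e) =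
      subst Chain (trans (sym (p-involutive z)) (cong p (sym (entered-by-partner (E⇒Step e) (¬-not ¬cy))))) rz

    chain-class : ∀ {y y′} → Chain y → y ∼ y′ → y ≢ y′ → AB y′ → Chain y′
    chain-class {y} {y′} r y∼y′ y≢y′ ABy′ with crossing y B.≟ true
    ... | no ¬cy = reach-snoc r (Step⇒E (chain-AB r , ABy′ ,
                                         subst (λ t → Link t y y′) (sym (¬-not ¬cy)) (y∼y′ , y≢y′)))
    ... | yes cy with reach-last r
    ...   | inj₁ refl with AB-class y∼y′ y≢y′ (inj₁ Lw≡a) ABy′
    ...     | inj₁ (_ , Ly′≡b) = ⊥-elim (b-missing (∼-trans px∼w y∼y′) Ly′≡b)
    ...     | inj₂ (Lw≡b , _)  = ⊥-elim (a≢b (just-injective (trans (sym Lw≡a) Lw≡b)))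
    chain-class {y} {y′} r y∼y′ y≢y′ ABy′ | yes cy | inj₂ (z , rz , e)
      with entered-in-class (E⇒Step e) cy | z ≟ y′
    ... | _         | yes refl = rz
    ... | z∼y , z≢y | no z≢y′  =
      ⊥-elim (no-three z∼y y∼y′ z≢y y≢y′ z≢y′ (chain-AB rz) (chain-AB r) ABy′)

    chain-avoids-b : ∀ {y} → Chain y → x ∼ y → L y ≢ just b
    chain-avoids-b r x∼y Ly≡b with reach-last r
    ... | inj₁ refl = a≢b (just-injective (trans (sym Lw≡a) Ly≡b))
    ... | inj₂ (z , rz , e) with entered-in-class (E⇒Step e) (crossing-b-near-x x∼y Ly≡b) | chain-AB rz
    ...   | z∼y , _   | inj₁ Lz≡a = a-missing (∼-trans x∼y (∼-sym z∼y)) Lz≡a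
    ...   | z∼y , z≢y | inj₂ Lz≡b = proper z∼y z≢y Lz≡b Ly≡b

    σ : Fin d → Fin d
    σ = transpose a b

    σ-a : σ a ≡ b
    σ-a rewrite dec-true (a ≟ a) refl = refl

    σ-b : σ b ≡ a
    σ-b rewrite dec-false (b ≟ a) (a≢b ∘ sym) | dec-true (b ≟ b) refl = refl

    σ-injective : Injective _≡_ _≡_ σ
    σ-injective {i} {j} σi≡σj =
      trans (sym (transpose-inverse b a)) (trans (cong (transpose b a) σi≡σj) (transpose-inverse b a))

    swapped : Partial
    swapped y = if does (reach? E w y) then Maybe.map σ (L y) else L y

    swapped-in : ∀ {y} → Chain y → swapped y ≡ Maybe.map σ (L y)
    swapped-in {y} r rewrite dec-true (reach? E w y) r = refl

    swapped-out : ∀ {y} → ¬ Chain y → swapped y ≡ L y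
    swapped-out {y} ¬r rewrite dec-false (reach? E w y) ¬r = refl

    swapped-a : ∀ {y} → Chain y → L y ≡ just a → swapped y ≡ just b
    swapped-a r Ly≡a = trans (swapped-in r) (trans (cong (Maybe.map σ) Ly≡a) (cong just σ-a))

    swapped-b : ∀ {y} → Chain y → L y ≡ just b → swapped y ≡ just a
    swapped-b r Ly≡b = trans (swapped-in r) (trans (cong (Maybe.map σ) Ly≡b) (cong just σ-b))

    swapped-labelled : ∀ y → swapped y ≡ nothing → L y ≡ nothing
    swapped-labelled y h with reach? E w y
    ... | no ¬r = trans (sym (swapped-out ¬r)) h
    ... | yes r with chain-AB r
    ...   | inj₁ Ly≡a = case trans (sym (swapped-a r Ly≡a)) h of λ ()
    ...   | inj₂ Ly≡b = case trans (sym (swapped-b r Ly≡b)) h of λ ()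

    chain-partner-⇔ : ∀ y → Chain (p y) ⇔ Chain y
    chain-partner-⇔ y = mk⇔ (subst Chain (p-involutive y) ∘ chain-partner) chain-partner

    swapped-partner : ∀ y → swapped (p y) ≡ swapped y
    swapped-partner y
      rewrite partner y | does-⇔ (chain-partner-⇔ y) (reach? E w (p y)) (reach? E w y) = refl

    swapped-mixed : ∀ {y y′ e} → Chain y → ¬ Chain y′ → y ∼ y′ → y ≢ y′ →
                    swapped y ≡ just e → swapped y′ ≢ just e
    swapped-mixed r ¬r′ y∼y′ y≢y′ L′y≡e L′y′≡e with chain-AB r
    ... | inj₁ Ly≡a = ¬r′ (chain-class r y∼y′ y≢y′ (inj₂ (trans (sym (swapped-out ¬r′))
                                    (trans L′y′≡e (trans (sym L′y≡e) (swapped-a r Ly≡a))))))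
    ... | inj₂ Ly≡b = ¬r′ (chain-class r y∼y′ y≢y′ (inj₁ (trans (sym (swapped-out ¬r′))
                                    (trans L′y′≡e (trans (sym L′y≡e) (swapped-b r Ly≡b))))))

    swapped-proper : ∀ {y y′ e} → y ∼ y′ → y ≢ y′ → swapped y ≡ just e → swapped y′ ≢ just e
    swapped-proper {y} {y′} y∼y′ y≢y′ L′y≡e L′y′≡e with reach? E w y | reach? E w y′
    ... | yes r | no ¬r′ = swapped-mixed r ¬r′ y∼y′ y≢y′ L′y≡e L′y′≡e
    ... | no ¬r | yes r′ = swapped-mixed r′ ¬r (∼-sym y∼y′) (y≢y′ ∘ sym) L′y′≡e L′y≡e
    ... | no ¬r | no ¬r′ =
          proper y∼y′ y≢y′ (trans (sym (swapped-out ¬r)) L′y≡e) (trans (sym (swapped-out ¬r′)) L′y′≡e)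
    ... | yes r | yes r′ with chain-AB r
    ...   | inj₁ Ly≡a = proper y∼y′ y≢y′ Ly≡a (trans (sym Ly≡Ly′) Ly≡a)
      where
      Ly≡Ly′ : L y ≡ L y′
      Ly≡Ly′ = M.map-injective σ-injective
                 (trans (sym (swapped-in r)) (trans L′y≡e (trans (sym L′y′≡e) (swapped-in r′))))
    ...   | inj₂ Ly≡b = proper y∼y′ y≢y′ Ly≡b (trans (sym Ly≡Ly′) Ly≡b)
      where
      Ly≡Ly′ : L y ≡ L y′
      Ly≡Ly′ = M.map-injective σ-injective
                 (trans (sym (swapped-in r)) (trans L′y≡e (trans (sym L′y′≡e) (swapped-in r′))))

    swapped-valid : Valid swapped
    swapped-valid = record { partner = swapped-partner ; proper = swapped-proper }

    swapped-missing-x : Missing swapped x a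
    swapped-missing-x {y} x∼y L′y≡a with reach? E w y
    ... | no ¬r = a-missing x∼y (trans (sym (swapped-out ¬r)) L′y≡a)
    ... | yes r with chain-AB r
    ...   | inj₁ Ly≡a = a-missing x∼y Ly≡a
    ...   | inj₂ Ly≡b = chain-avoids-b r x∼y Ly≡b

    swapped-missing-px : Missing swapped (p x) a
    swapped-missing-px {y} px∼y L′y≡a with reach? E w y
    ... | yes r with chain-AB r
    ...   | inj₁ Ly≡a = a≢b (just-injective (trans (sym L′y≡a) (swapped-a r Ly≡a)))
    ...   | inj₂ Ly≡b = b-missing px∼y Ly≡b
    swapped-missing-px {y} px∼y L′y≡a | no ¬r with w ≟ y
    ... | yes refl = ¬r here
    ... | no w≢y   = proper (∼-trans (∼-sym px∼w) px∼y) w≢y Lw≡a (trans (sym (swapped-out ¬r)) L′y≡a)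

  record Extension (L : Partial) (x : Fin n) : Set where
    field
      labelling    : Partial
      valid        : Valid labelling
      labels-x     : labelling x ≢ nothing
      keeps-labels : ∀ y → labelling y ≡ nothing → L y ≡ nothing

  assign-extension : ∀ {L x a} → Valid L → Missing L x a → Missing L (p x) a → Extension L x
  assign-extension {L} {x} {a} valid missing-x missing-px = record
    { labelling    = L [ x ↦ a ]
    ; valid        = assign-valid L x a valid missing-x missing-px
    ; labels-x     = λ L′x≡nothing → case trans (sym (assign-on L x a (inj₁ refl))) L′x≡nothing of λ ()
    ; keeps-labels = assign-labelled L x a
    }

  extend : ∀ {L} → Valid L → ∀ {x} → L x ≡ nothing → Extension L x
  extend {L} valid {x} Lx≡nothing
    with a , a-missing ← missing-colour L Lx≡nothing
       | b , b-missing ← missing-colour L (trans (Valid.partner valid x) Lx≡nothing)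
    with any? (λ y → (p x ∼? y) ×-dec (L y ≟ₘ just a))
  ... | no a-absent = assign-extension valid a-missing (λ px∼y Ly≡a → a-absent (_ , px∼y , Ly≡a))
  ... | yes (w , px∼w , Lw≡a) = record
    { Extension ext
    ; keeps-labels = λ y h → swapped-labelled y (Extension.keeps-labels ext y h)
    }
    where
    open Kempe valid a-missing b-missing px∼w Lw≡a
    ext : Extension swapped x
    ext = assign-extension swapped-valid swapped-missing-x swapped-missing-px

  unlabelled : Partial → Fin n → Bool
  unlabelled L y = does (L y ≟ₘ nothing)

  complete : ∀ m L → Valid L → count (unlabelled L) ≤ m →
             Σ Partial λ L′ → Valid L′ × ∀ y → Σ (Fin d) λ a → L′ y ≡ just a
  complete m L valid bound with any? (λ y → L y ≟ₘ nothing)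
  ... | no all-labelled = L , valid , labelled
    where
    labelled : ∀ y → Σ (Fin d) λ a → L y ≡ just a
    labelled y with L y in Ly
    ... | just a  = a , refl
    ... | nothing = ⊥-elim (all-labelled (y , Ly))
  ... | yes (x , Lx≡nothing) with m
  ...   | zero = case ≤-trans (subst (1 ≤_) (sym #unlabelled) (s≤s z≤n)) bound of λ ()
    where
    #unlabelled : count (unlabelled L) ≡ suc (count (unlabelled L ∖ x))
    #unlabelled = count-∖-true (unlabelled L) (dec-true (L x ≟ₘ nothing) Lx≡nothing)
  ...   | suc m = complete m labelling valid′ (≤-pred (<-≤-trans fewer bound))
    where
    open Extension (extend valid Lx≡nothing) renaming (valid to valid′)
    fewer : count (unlabelled labelling) < count (unlabelled L)
    fewer = count-mono-<
      (λ y h → dec-true (L y ≟ₘ nothing) (keeps-labels y (does-true (labelling y ≟ₘ nothing) h)))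
      x (dec-true (L x ≟ₘ nothing) Lx≡nothing) (dec-false (labelling x ≟ₘ nothing) labels-x)

  record ProperColouring : Set where
    field
      colour         : Fin n → Fin d
      colour-partner : ∀ x → colour (p x) ≡ colour x
      colour-proper  : ∀ {y y′} → y ∼ y′ → y ≢ y′ → colour y ≢ colour y′

  nothing-valid : Valid (λ _ → nothing)
  nothing-valid = record { partner = λ _ → refl ; proper = λ _ _ () }

  -- Abstract, so that type checking never unfolds the recolouring algorithm.
  abstract
    properColouring : ProperColouring
    properColouring with L , valid , total ← complete n (λ _ → nothing) nothing-valid (count≤ _) = record
      { colour         = λ y → proj₁ (total y)
      ; colour-partner = λ x → just-injective (trans (sym (proj₂ (total (p x))))
                                                      (trans (Valid.partner valid x) (proj₂ (total x))))
      ; colour-proper  = λ {y} {y′} y∼y′ y≢y′ same → Valid.proper valid y∼y′ y≢y′ (proj₂ (total y))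
                                                        (trans (proj₂ (total y′)) (cong just (sym same)))
      }

-- With the 5-cycle written 3 – 1 – 0 – 2 – 4 and hit j saying whether vertex j has
-- colour k, this counts the edges at 0 in the matching of colour k: the edge 01 if a
-- vertex flanking it (2 or 3) has colour k, the edge 02 if 1 or 4 does, and the
-- partner edge of 0 if 0 does.
incidences : (Fin 5 → Bool) → ℕ
incidences hit = one-if (hit (suc (suc zero)) ∨ hit (suc (suc (suc zero))))
               + (one-if (hit (suc zero) ∨ hit (suc (suc (suc (suc zero))))) + one-if (hit zero))

incidences-cong : {h h′ : Fin 5 → Bool} → (∀ j → h j ≡ h′ j) → incidences h ≡ incidences h′
incidences-cong eq rewrite eq zero | eq (suc zero) | eq (suc (suc zero)) | eq (suc (suc (suc zero)))
                         | eq (suc (suc (suc (suc zero)))) = refl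

incidences-position : ∀ m → incidences (λ j → does (m ≟ j)) ≡ 1
incidences-position zero                         = refl
incidences-position (suc zero)                   = refl
incidences-position (suc (suc zero))             = refl
incidences-position (suc (suc (suc zero)))       = refl
incidences-position (suc (suc (suc (suc zero)))) = refl

incidences-bijective : (l : Fin 5 → Fin 5) → Injective _≡_ _≡_ l →
                       ∀ k → incidences (λ j → does (k ≟ l j)) ≡ 1
incidences-bijective l l-injective k with m , lm≡k ← injective⇒surjective l l-injective k =
  trans (incidences-cong hit) (incidences-position m)
  where
  hit : ∀ j → does (k ≟ l j) ≡ does (m ≟ j)
  hit j = does-⇔ (mk⇔ (λ k≡lj → l-injective (trans lm≡k k≡lj)) (λ m≡j → trans (sym lm≡k) (cong l m≡j)))
                 (k ≟ l j) (m ≟ j)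

module FiveCycleFactor {n : ℕ} (G : Graph n) (cubic : Cubic G) (F : Rel n) (two-factor : IsTwoFactor G F)
  (five : ∀ v → ComponentHasFiveVertices F v) where

  F-sym : ∀ u v → F u v ≡ F v u
  F-sym = proj₁ (proj₁ two-factor)

  F⊆adj : ∀ {u v} → F u v ≡ true → adj G u v ≡ true
  F⊆adj = proj₂ (proj₁ two-factor) _ _

  F-irrefl : ∀ {u v} → F u v ≡ true → u ≢ v
  F-irrefl {u} Fuv refl = case trans (sym (F⊆adj Fuv)) (irrefl G u) of λ ()

  F-flip : ∀ {u v} → F u v ≡ true → F v u ≡ true
  F-flip {u} {v} Fuv = trans (F-sym v u) Fuv

  Q : Rel n
  Q u v = adj G u v ∧ not (F u v)

  Q-sym : ∀ u v → Q u v ≡ Q v u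
  Q-sym u v = cong₂ (λ s t → s ∧ not t) (Defs.sym G u v) (F-sym u v)

  Q⊆adj : ∀ {u v} → Q u v ≡ true → adj G u v ≡ true
  Q⊆adj {u} {v} h with adj G u v
  ... | true = refl

  Q⇒¬F : ∀ {u v} → Q u v ≡ true → F u v ≡ false
  Q⇒¬F {u} {v} h with adj G u v | F u v
  ... | true | false = refl

  Q-F : ∀ {u v} → F u v ≡ true → Q u v ≡ false
  Q-F {u} {v} Fuv rewrite Fuv = ∧-zeroʳ (adj G u v)

  adj-cases : ∀ {u v} → adj G u v ≡ true → F u v ≡ true ⊎ Q u v ≡ true
  adj-cases {u} {v} h with F u v
  ... | true  = inj₁ refl
  ... | false = inj₂ (trans (B.∧-identityʳ _) h)

  Q-degree : ∀ v → count (Q v) ≡ 1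
  Q-degree v = +-cancelˡ-≡ 2 (count (Q v)) 1 (begin
    2 + count (Q v)                                   ≡⟨ cong (_+ count (Q v)) (sym #F) ⟩
    count (λ y → adj G v y ∧ F v y) + count (Q v)     ≡⟨ sym (count-split (adj G v) (F v)) ⟩
    count (adj G v)                                   ≡⟨ cubic v ⟩
    3                                                 ∎)
    where
    open ≡-Reasoning
    F∧adj : ∀ y → (adj G v y ∧ F v y) ≡ F v y
    F∧adj y with F v y in Fvy
    ... | true  = cong (_∧ true) (F⊆adj Fvy)
    ... | false = ∧-zeroʳ (adj G v y)
    #F : count (λ y → adj G v y ∧ F v y) ≡ 2
    #F = trans (count-cong F∧adj) (proj₂ two-factor v)

  abstract
    partner : Fin n → Fin n
    partner x = proj₁ (count≡1⇒unique (Q x) (Q-degree x))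

    Q-partner : ∀ x → Q x (partner x) ≡ true
    Q-partner x = proj₁ (proj₂ (count≡1⇒unique (Q x) (Q-degree x)))

    Q⇒partner : ∀ {x y} → Q x y ≡ true → y ≡ partner x
    Q⇒partner {x} = proj₂ (proj₂ (count≡1⇒unique (Q x) (Q-degree x))) _

  partner-involutive : ∀ x → partner (partner x) ≡ x
  partner-involutive x = sym (Q⇒partner (trans (Q-sym (partner x) x) (Q-partner x)))

  abstract
    other : Fin n → Fin n → Fin n
    other u = proj₁ (count≡2⇒other (F u) (proj₂ two-factor u))

    other-spec : ∀ {u v} → F u v ≡ true → F u (other u v) ≡ true × other u v ≢ v ×
                 (∀ {y} → F u y ≡ true → y ≡ v ⊎ y ≡ other u v)
    other-spec {u} = proj₂ (count≡2⇒other (F u) (proj₂ two-factor u))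

  module _ {u v : Fin n} (Fuv : F u v ≡ true) where

    other-F : F u (other u v) ≡ true
    other-F = proj₁ (other-spec Fuv)

    other-≢ : other u v ≢ v
    other-≢ = proj₁ (proj₂ (other-spec Fuv))

    F-neighbour : ∀ {y} → F u y ≡ true → y ≡ v ⊎ y ≡ other u v
    F-neighbour = proj₂ (proj₂ (other-spec Fuv))

  other-involutive : ∀ {u v} → F u v ≡ true → other u (other u v) ≡ v
  other-involutive Fuv with F-neighbour (other-F Fuv) Fuv
  ... | inj₁ v≡ouv  = ⊥-elim (other-≢ Fuv (sym v≡ouv))
  ... | inj₂ v≡oouv = sym v≡oouv

  two-neighbours : ∀ {z s t y} → F z s ≡ true → F z t ≡ true → s ≢ t → F z y ≡ true → y ≡ s ⊎ y ≡ t
  two-neighbours Fzs Fzt s≢t Fzy with F-neighbour Fzs Fzt | F-neighbour Fzs Fzy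
  ... | inj₁ t≡s    | _ = ⊥-elim (s≢t (sym t≡s))
  ... | inj₂ t≡os   | inj₁ y≡s  = inj₁ y≡s
  ... | inj₂ t≡os   | inj₂ y≡os = inj₂ (trans y≡os (sym t≡os))

  -- Such a set contains the whole five-vertex cycle through x.
  closed-set-large : ∀ {m x} (g : Fin m → Fin n) → Σ (Fin m) (λ i → g i ≡ x) →
                     (∀ i {y} → F (g i) y ≡ true → Σ (Fin m) λ j → g j ≡ y) → 5 ≤ m
  closed-set-large {m} {x} g x∈g closed with f , f-injective , f-reach , _ ← five x =
    injective⇒≤ {f = index} λ {i} {j} eq → f-injective (trans (sym (proj₂ (reached (f-reach i) x∈g)))
                                              (trans (cong g eq) (proj₂ (reached (f-reach j) x∈g))))
    where
    reached : ∀ {u y} → Reach F u y → Σ (Fin m) (λ i → g i ≡ u) → Σ (Fin m) λ j → g j ≡ y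
    reached here       u∈g       = u∈g
    reached (step e r) (i , refl) = reached r (closed i e)
    index : Fin 5 → Fin m
    index i = proj₁ (reached (f-reach i) x∈g)

  among : ∀ {m} {g : Fin m → Fin n} {y} i j → y ≡ g i ⊎ y ≡ g j → Σ (Fin m) λ k → g k ≡ y
  among i j = [ (λ y≡gi → i , sym y≡gi) , (λ y≡gj → j , sym y≡gj) ]′

  no-triangle : ∀ {x u v} → F x u ≡ true → F x v ≡ true → u ≢ v → F u v ≡ true → ⊥
  no-triangle {x} {u} {v} Fxu Fxv u≢v Fuv = 5≰3 (closed-set-large g (zero , refl) closed)
    where
    g : Fin 3 → Fin n
    g zero             = x
    g (suc zero)       = u
    g (suc (suc zero)) = v
    closed : ∀ i {y} → F (g i) y ≡ true → Σ (Fin 3) λ j → g j ≡ y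
    closed zero             = among (suc zero) (suc (suc zero)) ∘ two-neighbours Fxu Fxv u≢v
    closed (suc zero)       = among zero (suc (suc zero)) ∘ two-neighbours (F-flip Fxu) Fuv (F-irrefl Fxv)
    closed (suc (suc zero)) = among zero (suc zero) ∘ two-neighbours (F-flip Fxv) (F-flip Fuv) (F-irrefl Fxu)
    5≰3 : ¬ (5 ≤ 3)
    5≰3 (s≤s (s≤s (s≤s ())))

  no-square : ∀ {x u v w} → F x u ≡ true → F x v ≡ true → u ≢ v →
              F u w ≡ true → F v w ≡ true → x ≢ w → ⊥
  no-square {x} {u} {v} {w} Fxu Fxv u≢v Fuw Fvw x≢w = 5≰4 (closed-set-large g (zero , refl) closed)
    where
    g : Fin 4 → Fin n
    g zero                   = x
    g (suc zero)             = u
    g (suc (suc zero))       = v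
    g (suc (suc (suc zero))) = w
    closed : ∀ i {y} → F (g i) y ≡ true → Σ (Fin 4) λ j → g j ≡ y
    closed zero                   = among (suc zero) (suc (suc zero)) ∘ two-neighbours Fxu Fxv u≢v
    closed (suc zero)             = among zero (suc (suc (suc zero))) ∘ two-neighbours (F-flip Fxu) Fuw x≢w
    closed (suc (suc zero))       = among zero (suc (suc (suc zero))) ∘ two-neighbours (F-flip Fxv) Fvw x≢w
    closed (suc (suc (suc zero))) = among (suc zero) (suc (suc zero)) ∘ two-neighbours (F-flip Fuw) (F-flip Fvw) u≢v
    5≰4 : ¬ (5 ≤ 4)
    5≰4 (s≤s (s≤s (s≤s (s≤s ()))))

  abstract
    first : Fin n → Fin n
    first x = proj₁ (count≡suc⇒witness (F x) (proj₂ two-factor x))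

    F-first : ∀ x → F x (first x) ≡ true
    F-first x = proj₂ (count≡suc⇒witness (F x) (proj₂ two-factor x))

  -- The cycle through x, listed as  x, a, b, a′, b′  where a′ – a – x – b – b′.
  cycle : Fin n → Fin 5 → Fin n
  cycle x zero                         = x
  cycle x (suc zero)                   = first x
  cycle x (suc (suc zero))             = other x (first x)
  cycle x (suc (suc (suc zero)))       = other (first x) x
  cycle x (suc (suc (suc (suc zero)))) = other (other x (first x)) x

  module Around (x : Fin n) where
    a b a′ b′ : Fin n
    a  = first x
    b  = other x a
    a′ = other a x
    b′ = other b x

    Fxa : F x a ≡ true
    Fxa = F-first x
    Fxb : F x b ≡ true
    Fxb = other-F Fxa
    Faa′ : F a a′ ≡ true
    Faa′ = other-F (F-flip Fxa)
    Fbb′ : F b b′ ≡ true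
    Fbb′ = other-F (F-flip Fxb)

    x≢a : x ≢ a
    x≢a = F-irrefl Fxa
    x≢b : x ≢ b
    x≢b = F-irrefl Fxb
    a≢b : a ≢ b
    a≢b = other-≢ Fxa ∘ sym
    a≢a′ : a ≢ a′
    a≢a′ = F-irrefl Faa′
    b≢b′ : b ≢ b′
    b≢b′ = F-irrefl Fbb′
    x≢a′ : x ≢ a′
    x≢a′ = other-≢ (F-flip Fxa) ∘ sym
    x≢b′ : x ≢ b′
    x≢b′ = other-≢ (F-flip Fxb) ∘ sym
    a≢b′ : a ≢ b′
    a≢b′ a≡b′ = no-triangle Fxb Fxa (a≢b ∘ sym) (subst (λ y → F b y ≡ true) (sym a≡b′) Fbb′)
    b≢a′ : b ≢ a′
    b≢a′ b≡a′ = no-triangle Fxa Fxb a≢b (subst (λ y → F a y ≡ true) (sym b≡a′) Faa′)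
    a′≢b′ : a′ ≢ b′
    a′≢b′ a′≡b′ = no-square Fxa Fxb a≢b Faa′ (subst (λ y → F b y ≡ true) (sym a′≡b′) Fbb′) x≢a′

  cycle-injective : ∀ x → Injective _≡_ _≡_ (cycle x)
  cycle-injective x {i} {j} = go i j
    where
    open Around x
    go : ∀ i j → cycle x i ≡ cycle x j → i ≡ j
    go zero zero _ = refl
    go zero (suc zero) e = ⊥-elim (x≢a e)
    go zero (suc (suc zero)) e = ⊥-elim (x≢b e)
    go zero (suc (suc (suc zero))) e = ⊥-elim (x≢a′ e)
    go zero (suc (suc (suc (suc zero)))) e = ⊥-elim (x≢b′ e)
    go (suc zero) zero e = ⊥-elim (x≢a (sym e))
    go (suc zero) (suc zero) _ = refl
    go (suc zero) (suc (suc zero)) e = ⊥-elim (a≢b e)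
    go (suc zero) (suc (suc (suc zero))) e = ⊥-elim (a≢a′ e)
    go (suc zero) (suc (suc (suc (suc zero)))) e = ⊥-elim (a≢b′ e)
    go (suc (suc zero)) zero e = ⊥-elim (x≢b (sym e))
    go (suc (suc zero)) (suc zero) e = ⊥-elim (a≢b (sym e))
    go (suc (suc zero)) (suc (suc zero)) _ = refl
    go (suc (suc zero)) (suc (suc (suc zero))) e = ⊥-elim (b≢a′ e)
    go (suc (suc zero)) (suc (suc (suc (suc zero)))) e = ⊥-elim (b≢b′ e)
    go (suc (suc (suc zero))) zero e = ⊥-elim (x≢a′ (sym e))
    go (suc (suc (suc zero))) (suc zero) e = ⊥-elim (a≢a′ (sym e))
    go (suc (suc (suc zero))) (suc (suc zero)) e = ⊥-elim (b≢a′ (sym e))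
    go (suc (suc (suc zero))) (suc (suc (suc zero))) _ = refl
    go (suc (suc (suc zero))) (suc (suc (suc (suc zero)))) e = ⊥-elim (a′≢b′ e)
    go (suc (suc (suc (suc zero)))) zero e = ⊥-elim (x≢b′ (sym e))
    go (suc (suc (suc (suc zero)))) (suc zero) e = ⊥-elim (a≢b′ (sym e))
    go (suc (suc (suc (suc zero)))) (suc (suc zero)) e = ⊥-elim (b≢b′ (sym e))
    go (suc (suc (suc (suc zero)))) (suc (suc (suc zero))) e = ⊥-elim (a′≢b′ (sym e))
    go (suc (suc (suc (suc zero)))) (suc (suc (suc (suc zero)))) _ = refl

  cycle-reach : ∀ x i → Reach F x (cycle x i)
  cycle-reach x zero                         = here
  cycle-reach x (suc zero)                   = step Fxa here where open Around x
  cycle-reach x (suc (suc zero))             = step Fxb here where open Around x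
  cycle-reach x (suc (suc (suc zero)))       = step Fxa (step Faa′ here) where open Around x
  cycle-reach x (suc (suc (suc (suc zero)))) = step Fxb (step Fbb′ here) where open Around x

  reach-isDecEquivalence : IsDecEquivalence (Reach F)
  reach-isDecEquivalence = record
    { isEquivalence = record { refl = here ; sym = reach-sym F-sym ; trans = reach-trans }
    ; _≟_           = reach? F
    }

  component-covered : ∀ x → Σ (Fin 5 → Fin n) λ f → ∀ {y} → Reach F x y → Σ (Fin 5) λ i → f i ≡ y
  component-covered x with f , _ , _ , cover ← five x = f , cover _

  module Covering (c : Fin n → Bool) (c-class : ∀ u v → Reach F u v → c u ≡ c v)
                  (c-edge : ∀ u v → adj G u v ≡ true → F u v ≡ false → c u ≢ c v) where

    c-partner : ∀ x → c (partner x) ≡ not (c x)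
    c-partner x = ¬-not (≢-sym (c-edge x (partner x) (Q⊆adj (Q-partner x)) (Q⇒¬F (Q-partner x))))

    open EdgeColouring reach-isDecEquivalence component-covered partner partner-involutive
                       c (c-class _ _) c-partner using (module ProperColouring; properColouring)
    open ProperColouring properColouring

    colour-cycle-injective : ∀ x → Injective _≡_ _≡_ (colour ∘ cycle x)
    colour-cycle-injective x {i} {j} same with i ≟ j
    ... | yes i≡j = i≡j
    ... | no  i≢j = ⊥-elim (colour-proper (reach-trans (reach-sym F-sym (cycle-reach x i)) (cycle-reach x j))
                                          (i≢j ∘ cycle-injective x) same)

    flanks-distinct : ∀ {u v} → F u v ≡ true → other u v ≢ other v u
    flanks-distinct {u} Fuv with F-neighbour (F-first u) Fuv
    ... | inj₁ refl = b≢a′ where open Around u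
    ... | inj₂ refl = λ same → a≢b′ (trans (sym (other-involutive Fxa)) same) where open Around u

    -- The partner edges of colour k and the cycle edges uv flanked by a vertex of
    -- colour k (other u v or other v u); on a 5-cycle these are the two edges next to
    -- its vertex of colour k.
    colourMatching : Fin 5 → Rel n
    colourMatching k u v =
      if F u v then does (k ≟ colour (other u v)) ∨ does (k ≟ colour (other v u))
               else Q u v ∧ does (k ≟ colour u)

    matching : Fin 6 → Rel n
    matching zero    = Q
    matching (suc k) = colourMatching k

    module _ (k : Fin 5) {u v : Fin n} where

      colourMatching-F : F u v ≡ true →
                         colourMatching k u v ≡ does (k ≟ colour (other u v)) ∨ does (k ≟ colour (other v u))
      colourMatching-F Fuv rewrite Fuv = refl

      colourMatching-Q : Q u v ≡ true → colourMatching k u v ≡ does (k ≟ colour u)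
      colourMatching-Q Quv =
        trans (cong (λ f → if f then does (k ≟ colour (other u v)) ∨ does (k ≟ colour (other v u))
                                 else Q u v ∧ does (k ≟ colour u)) (Q⇒¬F Quv))
              (cong (_∧ does (k ≟ colour u)) Quv)

      colourMatching-none : F u v ≡ false → Q u v ≡ false → colourMatching k u v ≡ false
      colourMatching-none ¬Fuv ¬Quv rewrite ¬Fuv = cong (_∧ does (k ≟ colour u)) ¬Quv

    edge-kind : ∀ u v → F u v ≡ true ⊎ Q u v ≡ true ⊎ (F u v ≡ false × Q u v ≡ false)
    edge-kind u v with F u v B.≟ true | Q u v B.≟ true
    ... | yes Fuv | _        = inj₁ Fuv
    ... | no ¬Fuv | yes Quv  = inj₂ (inj₁ Quv)
    ... | no ¬Fuv | no ¬Quv  = inj₂ (inj₂ (¬-not ¬Fuv , ¬-not ¬Quv))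

    colourMatching-sym : ∀ k u v → colourMatching k u v ≡ colourMatching k v u
    colourMatching-sym k u v with edge-kind u v
    ... | inj₁ Fuv = begin
      colourMatching k u v
        ≡⟨ colourMatching-F k Fuv ⟩
      does (k ≟ colour (other u v)) ∨ does (k ≟ colour (other v u))
        ≡⟨ ∨-comm (does (k ≟ colour (other u v))) _ ⟩
      does (k ≟ colour (other v u)) ∨ does (k ≟ colour (other u v))
        ≡⟨ sym (colourMatching-F k (F-flip Fuv)) ⟩
      colourMatching k v u ∎
      where open ≡-Reasoning
    ... | inj₂ (inj₁ Quv) = begin
      colourMatching k u v           ≡⟨ colourMatching-Q k Quv ⟩
      does (k ≟ colour u)            ≡⟨ cong (λ y → does (k ≟ colour y)) (sym (partner-involutive u)) ⟩
      does (k ≟ colour (partner (partner u)))  ≡⟨ cong (λ y → does (k ≟ y)) (colour-partner (partner u)) ⟩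
      does (k ≟ colour (partner u))  ≡⟨ cong (λ y → does (k ≟ colour y)) (sym (Q⇒partner Quv)) ⟩
      does (k ≟ colour v)            ≡⟨ sym (colourMatching-Q k (trans (Q-sym v u) Quv)) ⟩
      colourMatching k v u           ∎
      where open ≡-Reasoning
    ... | inj₂ (inj₂ (¬Fuv , ¬Quv)) =
      trans (colourMatching-none k ¬Fuv ¬Quv)
            (sym (colourMatching-none k (trans (F-sym v u) ¬Fuv) (trans (Q-sym v u) ¬Quv)))

    colourMatching⊆adj : ∀ k {u v} → colourMatching k u v ≡ true → adj G u v ≡ true
    colourMatching⊆adj k {u} {v} h with edge-kind u v
    ... | inj₁ Fuv                  = F⊆adj Fuv
    ... | inj₂ (inj₁ Quv)           = Q⊆adj Quv
    ... | inj₂ (inj₂ (¬Fuv , ¬Quv)) = case trans (sym h) (colourMatching-none k ¬Fuv ¬Quv) of λ ()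

    adj-neighbours : ∀ x {y} → adj G x y ≡ true → y ≡ first x ⊎ y ≡ other x (first x) ⊎ y ≡ partner x
    adj-neighbours x Axy with adj-cases Axy
    ... | inj₁ Fxy = Sum.map₂ inj₁ (F-neighbour (F-first x) Fxy)
    ... | inj₂ Qxy = inj₂ (inj₂ (Q⇒partner Qxy))

    colourMatching-degree : ∀ k x → count (colourMatching k x) ≡ 1
    colourMatching-degree k x = begin
      count (colourMatching k x)
        ≡⟨ count-three-points (colourMatching k x) a≢b (F≢partner Fxa) (F≢partner Fxb)
                                (λ y → adj-neighbours x ∘ colourMatching⊆adj k) ⟩
      one-if (colourMatching k x a) + (one-if (colourMatching k x b) + one-if (colourMatching k x (partner x)))
        ≡⟨ cong₂ (λ s t → one-if s + (one-if t + one-if (colourMatching k x (partner x))))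
                 (colourMatching-F k Fxa) (colourMatching-F k Fxb) ⟩
      one-if (hit (suc (suc zero)) ∨ hit (suc (suc (suc zero))))
        + (one-if (does (k ≟ colour (other x b)) ∨ hit (suc (suc (suc (suc zero)))))
           + one-if (colourMatching k x (partner x)))
        ≡⟨ cong₂ (λ s t → one-if (hit (suc (suc zero)) ∨ hit (suc (suc (suc zero))))
                           + (one-if (does (k ≟ colour s) ∨ hit (suc (suc (suc (suc zero))))) + one-if t))
                 (other-involutive Fxa) (colourMatching-Q k (Q-partner x)) ⟩
      incidences hit
        ≡⟨ incidences-bijective (colour ∘ cycle x) (colour-cycle-injective x) k ⟩
      1 ∎
      where
      open ≡-Reasoning
      open Around x
      hit : Fin 5 → Bool
      hit j = does (k ≟ colour (cycle x j))
      F≢partner : ∀ {y} → F x y ≡ true → y ≢ partner x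
      F≢partner Fxy refl = case trans (sym Fxy) (Q⇒¬F (Q-partner x)) of λ ()

    covered-twice : ∀ u v → adj G u v ≡ true → count (λ i → matching i u v) ≡ 2
    covered-twice u v Auv with adj-cases Auv
    ... | inj₁ Fuv = begin
      count (λ i → matching i u v)
        ≡⟨ count-suc (λ i → matching i u v) ⟩
      one-if (Q u v) + count (λ k → colourMatching k u v)
        ≡⟨ cong₂ (λ s t → one-if s + t) (Q-F Fuv) (count-cong (λ k → colourMatching-F k Fuv)) ⟩
      count (λ k → does (k ≟ colour (other u v)) ∨ does (k ≟ colour (other v u)))
        ≡⟨ count-either (colour-proper flank-path (flanks-distinct Fuv)) ⟩
      2 ∎
      where
      open ≡-Reasoning
      flank-path : Reach F (other u v) (other v u)
      flank-path = step (F-flip (other-F Fuv)) (step Fuv (step (other-F (F-flip Fuv)) here))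
    ... | inj₂ Quv = begin
      count (λ i → matching i u v)
        ≡⟨ count-suc (λ i → matching i u v) ⟩
      one-if (Q u v) + count (λ k → colourMatching k u v)
        ≡⟨ cong₂ (λ s t → one-if s + t) Quv (count-cong (λ k → colourMatching-Q k Quv)) ⟩
      1 + count (λ k → does (k ≟ colour u))
        ≡⟨ cong (1 +_) (count-point (λ _ → true) (colour u)) ⟩
      2 ∎
      where open ≡-Reasoning

    fulkersonCovering : FulkersonCovering G
    fulkersonCovering = matching , perfect , covered-twice
      where
      perfect : ∀ i → IsPerfectMatching G (matching i)
      perfect zero    = (Q-sym , λ _ _ → Q⊆adj) , Q-degree
      perfect (suc k) = (colourMatching-sym k , λ _ _ → colourMatching⊆adj k) , colourMatching-degree k

theorem5p2 : (n : ℕ) (G : Graph n) → Cubic G → Bridgeless G →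
    (F : Rel n) → IsTwoFactor G F →
    (∀ v → ComponentHasFiveVertices F v) → CyclesChordless G F →
    ContractionBipartite G F → FulkersonCovering G
theorem5p2 n G cubic _ F two-factor five _ (c , c-class , c-edge) = fulkersonCovering
  where open FiveCycleFactor G cubic F two-factor five
        open Covering c c-class c-edge
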